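{- Let $n\geq 3$ be odd, $k=\frac{n-3}{2}$, $G=(V,E)=K_n$, let $C=(v_1,\dots,v_{2k+1})$ be a cycle of length $n-2$ in $G$, and let $s,t$ be the two vertices not on $C$. Define the matrix $a\in\mathbb{Z}^{V^+\times V^- }$ by \[a(u^+,v^-)=\begin{cases}0 & u=v,\\ \bigl|2k+1-2|i-j|\bigr| & u=v_i,\ v=v_j,\ i\neq j,\\ k & |\{u,v\}\cap\{s,t\}|=1,\\ 1 & \{u,v\}=\{s,t\}.\end{cases}\] Let $\mu\in\mathbb{R}\setminus\{0\}$ and $\lambda\in\mathbb{R}^{V^+\cup V^- }$ be such that the matrix $a^{\mu,\lambda}$ with entries $a^{\mu,\lambda}(u^+,v^-)=\mu\cdot a(u^+,v^-)+\lambda_{u^+}+\lambda_{v^- }$ ($u,v\in V$) is integral. Then: (1) the largest absolute value of an entry of $a^{\mu,\lambda}$ is at least $\frac{n-4}{2}$; (2) the number of distinct entries of $a^{\mu,\lambda}$ is at least $\sqrt{\frac{n-1}{2}}$.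
   Context: $V^{\pm}=\{v^{\pm}\colon v\in V\}$ are two disjoint copies of $V$. The matrix $a$ is the coefficient vector, indexed by edges $\{u^+,v^-\}$ of the complete bipartite graph on $V^+\cup V^-$, of the canonical transformation of the $C$-induced constraint; the matrices $a^{\mu,\lambda}$ are exactly the coefficient vectors of the constraints obtained from it by scaling by $\mu$ and adding linear combinations of degree constraints.
   Formalization: The scalar μ and the entries of λ are rational rather than real. -}

module Defs where

open import Data.Nat using (ℕ; zero; suc; _+_; _*_; ∣_-_∣)
open import Data.Fin using (Fin)
import Data.Fin as Fin
open import Data.Sum using (_⊎_; inj₁; inj₂)
open import Data.List using (List; map; allFin; _++_; concatMap; deduplicate; length)
open import Data.Integer using (ℤ; +_)
import Data.Integer as ℤ
open import Relation.Nullary using (yes; no)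

nV : ℕ → ℕ
nV k = 2 * k + 3

-- Vertex set of K_n: the cycle vertices v_1,…,v_{2k+1} (as inj₁ i, i : Fin (2k+1),
-- i.e. v_{i+1}) together with the two remaining vertices s = inj₂ 0, t = inj₂ 1.
V : ℕ → Set
V k = Fin (2 * k + 1) ⊎ Fin 2

allV : (k : ℕ) → List (V k)
allV k = map inj₁ (allFin (2 * k + 1)) ++ map inj₂ (allFin 2)

a : (k : ℕ) → V k → V k → ℕ
a k (inj₁ i) (inj₁ j) with i Fin.≟ j
... | yes _ = 0
... | no _  = ∣ (2 * k + 1) - 2 * ∣ Fin.toℕ i - Fin.toℕ j ∣ ∣
a k (inj₁ _) (inj₂ _) = k
a k (inj₂ _) (inj₁ _) = k
a k (inj₂ x) (inj₂ y) with x Fin.≟ y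
... | yes _ = 0
... | no _  = 1

entries : (k : ℕ) → (V k → V k → ℤ) → List ℤ
entries k b = concatMap (λ u → map (b u) (allV k)) (allV k)

numDistinct : (k : ℕ) → (V k → V k → ℤ) → ℕ
numDistinct k b = length (deduplicate ℤ._≟_ (entries k b))

{-# OPTIONS --safe #-}
-- Adding potentials λ⁺ u + λ⁻ v to a matrix does not change its mixed second differences
-- Δ f u u' v v' = f u v - f u v' - f u' v + f u' v', so Δ b = μ · Δ a.  As Δ a s v₁ t s = 1,
-- μ = Δ b s v₁ t s is a nonzero integer m, and Δ b = m · Δ a holds over ℤ.
-- (1) Δ a v₁ v₂ v₂ v₁ = 2(2k - 1), so |Δ b v₁ v₂ v₂ v₁| ≥ 4k - 2 and one of its four entries
--     has absolute value at least k.
-- (2) On rows v₁, s and columns vᵢ, vⱼ (i, j ≤ k + 1) Δ a equals a(v₁, vᵢ) - a(v₁, vⱼ), which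
--     vanishes only for i = j (the values are 0 and the odd numbers 2k + 3 - 2j).  So these k + 1
--     columns restricted to rows v₁, s give k + 1 distinct pairs of entries of b, and
--     numDistinct² ≥ k + 1.
module Submission where

open import Defs
open import Data.Nat using (ℕ; zero; suc; z≤n; s≤s; _+_; _*_; _≤_; _<_; _∸_; ∣_-_∣)
import Data.Nat as ℕ
import Data.Nat.Properties as ℕP
open import Data.Nat.ListAction using (sum)
import Data.Nat.Tactic.RingSolver as ℕSolver
open import Data.Integer using (ℤ; +_; ∣_∣)
import Data.Integer as ℤ
import Data.Integer.Properties as ℤP
open import Data.Rational using (ℚ; _/_; 0ℚ; toℚᵘ)
import Data.Rational as ℚ
import Data.Rational.Properties as ℚP
open import Data.Rational.Solver using (module +-*-Solver)
open import Data.Rational.Unnormalised using (mkℚᵘ; *≡*) renaming (_≃_ to _≃ᵘ_)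
import Data.Rational.Unnormalised as ℚᵘ
import Data.Rational.Unnormalised.Properties as ℚᵘP
open import Data.Fin using (Fin; zero; suc; toℕ)
import Data.Fin as Fin
import Data.Fin.Properties as FinP
open import Data.Sum using (inj₁; inj₂; [_,_]′)
open import Data.Product using (_×_; _,_; ∃; ∃₂; uncurry)
open import Data.Product.Properties using (,-injective)
open import Data.List using (List; []; _∷_; _++_; length; lookup; map; deduplicate; cartesianProduct)
open import Data.List.Properties using (length-++; length-map)
open import Data.List.Relation.Unary.Any using (Any; here; there; satisfied; index)
open import Data.List.Relation.Unary.Any.Properties using (map⁻; lookup-index)
open import Data.List.Membership.Propositional using (_∈_; lose)
open import Data.List.Membership.Propositional.Properties
  using (∈-map⁺; ∈-++⁺ˡ; ∈-++⁺ʳ; ∈-allFin; ∈-concatMap⁺; ∈-deduplicate⁺; ∈-cartesianProduct⁺)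
open import Function using (Injective; _∘_; id)
open import Relation.Nullary using (yes; no; contradiction)
open import Relation.Binary.PropositionalEquality
  using (_≡_; _≢_; refl; sym; trans; cong; cong₂; subst; module ≡-Reasoning)

ι : ℤ → ℚ
ι i = i / 1

toℚᵘ-ι : ∀ i → toℚᵘ (ι i) ≃ᵘ mkℚᵘ i 0
toℚᵘ-ι i = ℚP.toℚᵘ-fromℚᵘ (mkℚᵘ i 0)

ι-injective : ∀ {i j} → ι i ≡ ι j → i ≡ j
ι-injective {i} {j} eq with ℚP.fromℚᵘ-injective {mkℚᵘ i 0} {mkℚᵘ j 0} eq
... | *≡* i*1≡j*1 = begin
  i          ≡⟨ ℤP.*-identityʳ i ⟨
  i ℤ.* + 1  ≡⟨ i*1≡j*1 ⟩
  j ℤ.* + 1  ≡⟨ ℤP.*-identityʳ j ⟩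
  j          ∎
  where open ≡-Reasoning

ι-homo-+ : ∀ i j → ι (i ℤ.+ j) ≡ ι i ℚ.+ ι j
ι-homo-+ i j = ℚP.toℚᵘ-injective (begin
  toℚᵘ (ι (i ℤ.+ j))         ≈⟨ toℚᵘ-ι (i ℤ.+ j) ⟩
  mkℚᵘ (i ℤ.+ j) 0           ≈⟨ *≡* (cong (ℤ._* + 1) (sym (cong₂ ℤ._+_ (ℤP.*-identityʳ i) (ℤP.*-identityʳ j)))) ⟩
  mkℚᵘ i 0 ℚᵘ.+ mkℚᵘ j 0     ≈⟨ ℚᵘP.+-cong (toℚᵘ-ι i) (toℚᵘ-ι j) ⟨
  toℚᵘ (ι i) ℚᵘ.+ toℚᵘ (ι j) ≈⟨ ℚP.toℚᵘ-homo-+ (ι i) (ι j) ⟨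
  toℚᵘ (ι i ℚ.+ ι j)         ∎)
  where open ℚᵘP.≃-Reasoning

ι-homo-* : ∀ i j → ι (i ℤ.* j) ≡ ι i ℚ.* ι j
ι-homo-* i j = ℚP.toℚᵘ-injective (begin
  toℚᵘ (ι (i ℤ.* j))         ≈⟨ toℚᵘ-ι (i ℤ.* j) ⟩
  mkℚᵘ i 0 ℚᵘ.* mkℚᵘ j 0     ≈⟨ ℚᵘP.*-cong (toℚᵘ-ι i) (toℚᵘ-ι j) ⟨
  toℚᵘ (ι i) ℚᵘ.* toℚᵘ (ι j) ≈⟨ ℚP.toℚᵘ-homo-* (ι i) (ι j) ⟨
  toℚᵘ (ι i ℚ.* ι j)         ∎)
  where open ℚᵘP.≃-Reasoning

ι-homo‿- : ∀ i → ι (ℤ.- i) ≡ ℚ.- ι i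
ι-homo‿- i = ℚP.toℚᵘ-injective (begin
  toℚᵘ (ι (ℤ.- i))  ≈⟨ toℚᵘ-ι (ℤ.- i) ⟩
  ℚᵘ.- mkℚᵘ i 0     ≈⟨ ℚᵘP.-‿cong (toℚᵘ-ι i) ⟨
  ℚᵘ.- toℚᵘ (ι i)   ≈⟨ ℚP.toℚᵘ-homo‿- (ι i) ⟨
  toℚᵘ (ℚ.- ι i)    ∎)
  where open ℚᵘP.≃-Reasoning

ι-homo-minus : ∀ i j → ι (i ℤ.- j) ≡ ι i ℚ.- ι j
ι-homo-minus i j = trans (ι-homo-+ i (ℤ.- j)) (cong (ι i ℚ.+_) (ι-homo‿- j))

Δ : {X Y : Set} → (X → Y → ℤ) → X → X → Y → Y → ℤ
Δ f u u' v v' = f u v ℤ.- f u v' ℤ.- f u' v ℤ.+ f u' v'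

ι-Δ : ∀ {X Y : Set} (f : X → Y → ℤ) u u' v v' →
      ι (Δ f u u' v v') ≡ ι (f u v) ℚ.- ι (f u v') ℚ.- ι (f u' v) ℚ.+ ι (f u' v')
ι-Δ f u u' v v' = begin
  ι (Δ f u u' v v')
    ≡⟨ ι-homo-+ (f u v ℤ.- f u v' ℤ.- f u' v) (f u' v') ⟩
  ι (f u v ℤ.- f u v' ℤ.- f u' v) ℚ.+ ι (f u' v')
    ≡⟨ cong (ℚ._+ ι (f u' v')) (ι-homo-minus (f u v ℤ.- f u v') (f u' v)) ⟩
  ι (f u v ℤ.- f u v') ℚ.- ι (f u' v) ℚ.+ ι (f u' v')
    ≡⟨ cong (λ q → q ℚ.- ι (f u' v) ℚ.+ ι (f u' v')) (ι-homo-minus (f u v) (f u v')) ⟩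
  ι (f u v) ℚ.- ι (f u v') ℚ.- ι (f u' v) ℚ.+ ι (f u' v') ∎
  where open ≡-Reasoning

mixed-difference-scale-shift : ∀ μ a₁ a₂ a₃ a₄ p p' q q' →
  (μ ℚ.* a₁ ℚ.+ p ℚ.+ q) ℚ.- (μ ℚ.* a₂ ℚ.+ p ℚ.+ q') ℚ.- (μ ℚ.* a₃ ℚ.+ p' ℚ.+ q) ℚ.+ (μ ℚ.* a₄ ℚ.+ p' ℚ.+ q')
    ≡ μ ℚ.* (a₁ ℚ.- a₂ ℚ.- a₃ ℚ.+ a₄)
mixed-difference-scale-shift = solve 9 (λ μ a₁ a₂ a₃ a₄ p p' q q' →
  (μ :* a₁ :+ p :+ q) :- (μ :* a₂ :+ p :+ q') :- (μ :* a₃ :+ p' :+ q) :+ (μ :* a₄ :+ p' :+ q')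
    := μ :* (a₁ :- a₂ :- a₃ :+ a₄)) refl
  where open +-*-Solver

module _ {X Y : Set} {μ : ℚ} {λ⁺ : X → ℚ} {λ⁻ : Y → ℚ} (A b : X → Y → ℤ)
         (b≡μA+λ : ∀ u v → μ ℚ.* ι (A u v) ℚ.+ λ⁺ u ℚ.+ λ⁻ v ≡ ι (b u v)) where

  ι-Δ-scale-shift : ∀ u u' v v' → ι (Δ b u u' v v') ≡ μ ℚ.* ι (Δ A u u' v v')
  ι-Δ-scale-shift u u' v v' = begin
    ι (Δ b u u' v v')
      ≡⟨ ι-Δ b u u' v v' ⟩
    ι (b u v) ℚ.- ι (b u v') ℚ.- ι (b u' v) ℚ.+ ι (b u' v')
      ≡⟨ cong₂ ℚ._+_ (cong₂ ℚ._-_ (cong₂ ℚ._-_ (b≡μA+λ u v) (b≡μA+λ u v')) (b≡μA+λ u' v)) (b≡μA+λ u' v') ⟨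
    _ ≡⟨ mixed-difference-scale-shift μ (ι (A u v)) (ι (A u v')) (ι (A u' v)) (ι (A u' v'))
                                        (λ⁺ u) (λ⁺ u') (λ⁻ v) (λ⁻ v') ⟩
    μ ℚ.* (ι (A u v) ℚ.- ι (A u v') ℚ.- ι (A u' v) ℚ.+ ι (A u' v'))
      ≡⟨ cong (μ ℚ.*_) (ι-Δ A u u' v v') ⟨
    μ ℚ.* ι (Δ A u u' v v') ∎
    where open ≡-Reasoning

  Δ-integral-multiple : μ ≢ 0ℚ → ∀ u₀ u₀' v₀ v₀' → Δ A u₀ u₀' v₀ v₀' ≡ ℤ.1ℤ →
    ∃ λ m → m ≢ ℤ.0ℤ × (∀ u u' v v' → Δ b u u' v v' ≡ m ℤ.* Δ A u u' v v')
  Δ-integral-multiple μ≢0 u₀ u₀' v₀ v₀' ΔA₀≡1 = m , m≢0 , Δb≡m*ΔA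
    where
    m : ℤ
    m = Δ b u₀ u₀' v₀ v₀'

    ιm≡μ : ι m ≡ μ
    ιm≡μ = begin
      ι m                         ≡⟨ ι-Δ-scale-shift u₀ u₀' v₀ v₀' ⟩
      μ ℚ.* ι (Δ A u₀ u₀' v₀ v₀') ≡⟨ cong (λ d → μ ℚ.* ι d) ΔA₀≡1 ⟩
      μ ℚ.* ℚ.1ℚ                  ≡⟨ ℚP.*-identityʳ μ ⟩
      μ                           ∎
      where open ≡-Reasoning

    m≢0 : m ≢ ℤ.0ℤ
    m≢0 m≡0 = μ≢0 (trans (sym ιm≡μ) (cong ι m≡0))

    Δb≡m*ΔA : ∀ u u' v v' → Δ b u u' v v' ≡ m ℤ.* Δ A u u' v v'
    Δb≡m*ΔA u u' v v' = ι-injective (begin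
      ι (Δ b u u' v v')          ≡⟨ ι-Δ-scale-shift u u' v v' ⟩
      μ ℚ.* ι (Δ A u u' v v')    ≡⟨ cong (ℚ._* ι (Δ A u u' v v')) ιm≡μ ⟨
      ι m ℚ.* ι (Δ A u u' v v')  ≡⟨ ι-homo-* m (Δ A u u' v v') ⟨
      ι (m ℤ.* Δ A u u' v v')    ∎)
      where open ≡-Reasoning

Δ-constant-row : ∀ {X Y : Set} (f : X → Y → ℤ) u u' v v' →
                 f u' v ≡ f u' v' → Δ f u u' v v' ≡ f u v ℤ.- f u v'
Δ-constant-row f u u' v v' eq rewrite eq = //-rightDividesˡ (f u' v') (f u v ℤ.- f u v')
  where open import Algebra.Properties.AbelianGroup ℤP.+-0-abelianGroup using (//-rightDividesˡ)

Δ-zero-diagonal : ∀ {X : Set} (f : X → X → ℤ) u u' → f u u ≡ ℤ.0ℤ → f u' u' ≡ ℤ.0ℤ →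
                  Δ f u u' u' u ≡ f u u' ℤ.+ f u' u
Δ-zero-diagonal f u u' fuu≡0 fu'u'≡0 rewrite fuu≡0 | fu'u'≡0 =
  cong (ℤ._+ f u' u) (trans (ℤP.+-identityʳ _) (ℤP.+-identityʳ (f u u')))

sum-pigeonhole : ∀ n (xs : List ℕ) → length xs * n < sum xs → Any (n <_) xs
sum-pigeonhole n (x ∷ xs) n+len*n<x+sum with n ℕ.<? x
... | yes n<x = here n<x
... | no n≮x = there (sum-pigeonhole n xs (ℕP.+-cancelˡ-< n _ _
  (ℕP.<-≤-trans n+len*n<x+sum (ℕP.+-monoˡ-≤ (sum xs) (ℕP.≮⇒≥ n≮x)))))

corners : {X Y : Set} → X → X → Y → Y → List (X × Y)
corners u u' v v' = (u , v) ∷ (u , v') ∷ (u' , v) ∷ (u' , v') ∷ []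

∣Δ∣≤sum∣corners∣ : ∀ {X Y : Set} (f : X → Y → ℤ) u u' v v' →
                   ∣ Δ f u u' v v' ∣ ≤ sum (map (∣_∣ ∘ uncurry f) (corners u u' v v'))
∣Δ∣≤sum∣corners∣ f u u' v v' = begin
  ∣ f u v ℤ.- f u v' ℤ.- f u' v ℤ.+ f u' v' ∣
    ≤⟨ ℤP.∣i+j∣≤∣i∣+∣j∣ (f u v ℤ.- f u v' ℤ.- f u' v) (f u' v') ⟩
  ∣ f u v ℤ.- f u v' ℤ.- f u' v ∣ + ∣ f u' v' ∣
    ≤⟨ ℕP.+-monoˡ-≤ _ (ℤP.∣i-j∣≤∣i∣+∣j∣ (f u v ℤ.- f u v') (f u' v)) ⟩
  ∣ f u v ℤ.- f u v' ∣ + ∣ f u' v ∣ + ∣ f u' v' ∣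
    ≤⟨ ℕP.+-monoˡ-≤ _ (ℕP.+-monoˡ-≤ _ (ℤP.∣i-j∣≤∣i∣+∣j∣ (f u v) (f u v'))) ⟩
  ∣ f u v ∣ + ∣ f u v' ∣ + ∣ f u' v ∣ + ∣ f u' v' ∣
    ≡⟨ reassociate (∣ f u v ∣) (∣ f u v' ∣) (∣ f u' v ∣) (∣ f u' v' ∣) ⟩
  ∣ f u v ∣ + (∣ f u v' ∣ + (∣ f u' v ∣ + (∣ f u' v' ∣ + 0))) ∎
  where
  open ℕP.≤-Reasoning
  reassociate : ∀ a b c d → a + b + c + d ≡ a + (b + (c + (d + 0)))
  reassociate = ℕSolver.solve-∀

Δ-large-entry : ∀ {X Y : Set} (f : X → Y → ℤ) u u' v v' n →
                4 * n < ∣ Δ f u u' v v' ∣ → ∃₂ λ x y → n < ∣ f x y ∣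
Δ-large-entry f u u' v v' n 4n<∣Δ∣ =
  let (x , y) , n<∣fxy∣ = satisfied (map⁻ {xs = corners u u' v v'}
        (sum-pigeonhole n (map (∣_∣ ∘ uncurry f) (corners u u' v v'))
          (ℕP.<-≤-trans 4n<∣Δ∣ (∣Δ∣≤sum∣corners∣ f u u' v v'))))
  in x , y , n<∣fxy∣

∣i∣≤∣j*i∣ : ∀ {j} i → j ≢ ℤ.0ℤ → ∣ i ∣ ≤ ∣ j ℤ.* i ∣
∣i∣≤∣j*i∣ {j} i j≢0 = begin
  ∣ i ∣          ≤⟨ ℕP.m≤n*m ∣ i ∣ ∣ j ∣ {{ℕ.≢-nonZero (j≢0 ∘ ℤP.∣i∣≡0⇒i≡0)}} ⟩
  ∣ j ∣ * ∣ i ∣  ≡⟨ ℤP.∣i*j∣≡∣i∣*∣j∣ j i ⟨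
  ∣ j ℤ.* i ∣    ∎
  where open ℕP.≤-Reasoning

length-cartesianProduct : ∀ {A B : Set} (xs : List A) (ys : List B) →
                          length (cartesianProduct xs ys) ≡ length xs * length ys
length-cartesianProduct [] ys = refl
length-cartesianProduct (x ∷ xs) ys = begin
  length (map (x ,_) ys ++ cartesianProduct xs ys)
    ≡⟨ length-++ (map (x ,_) ys) ⟩
  length (map (x ,_) ys) + length (cartesianProduct xs ys)
    ≡⟨ cong₂ _+_ (length-map (x ,_) ys) (length-cartesianProduct xs ys) ⟩
  length ys + length xs * length ys ∎
  where open ≡-Reasoning

injective⇒≤-length : ∀ {A : Set} {n} {f : Fin n → A} (xs : List A) →
                     Injective _≡_ _≡_ f → (∀ i → f i ∈ xs) → n ≤ length xs
injective⇒≤-length {f = f} xs f-injective f∈xs = FinP.injective⇒≤ index-injective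
  where
  index-injective : Injective _≡_ _≡_ (λ i → index (f∈xs i))
  index-injective {i} {j} eq = f-injective (begin
    f i                         ≡⟨ lookup-index (f∈xs i) ⟩
    lookup xs (index (f∈xs i))  ≡⟨ cong (lookup xs) eq ⟩
    lookup xs (index (f∈xs j))  ≡⟨ lookup-index (f∈xs j) ⟨
    f j                         ∎)
    where open ≡-Reasoning

∣m-n∣+n≡m : ∀ {m n} → n ≤ m → ∣ m - n ∣ + n ≡ m
∣m-n∣+n≡m n≤m = trans (cong (_+ _) (ℕP.m≤n⇒∣n-m∣≡n∸m n≤m)) (ℕP.m∸n+n≡m n≤m)

1+k≤2k+1 : ∀ k → suc k ≤ 2 * k + 1
1+k≤2k+1 k = ℕP.≤-trans (ℕP.m≤m+n (suc k) (k + 0)) (ℕP.≤-reflexive (ℕP.+-comm 1 (2 * k)))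

module _ (k : ℕ) where

  s t : V k
  s = inj₂ zero
  t = inj₂ (suc zero)

  -- cycleVertex j is v_(j+1); only the first k + 1 vertices of the cycle are needed.
  cycleVertex : Fin (suc k) → V k
  cycleVertex j = inj₁ (Fin.inject≤ j (1+k≤2k+1 k))

  aℤ : V k → V k → ℤ
  aℤ u v = + a k u v

  a-diagonal : ∀ u → a k u u ≡ 0
  a-diagonal (inj₁ i) with i Fin.≟ i
  ... | yes _  = refl
  ... | no i≢i = contradiction refl i≢i
  a-diagonal (inj₂ x) with x Fin.≟ x
  ... | yes _  = refl
  ... | no x≢x = contradiction refl x≢x

  a-cycle : ∀ i j → i ≢ j → a k (cycleVertex i) (cycleVertex j) + 2 * ∣ toℕ i - toℕ j ∣ ≡ 2 * k + 1
  a-cycle i j i≢j with Fin.inject≤ i (1+k≤2k+1 k) Fin.≟ Fin.inject≤ j (1+k≤2k+1 k)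
  ... | yes i≡j = contradiction (FinP.inject≤-injective _ _ i j i≡j) i≢j
  ... | no _ rewrite FinP.toℕ-inject≤ i (1+k≤2k+1 k) | FinP.toℕ-inject≤ j (1+k≤2k+1 k) =
    ∣m-n∣+n≡m (ℕP.≤-trans (ℕP.*-monoʳ-≤ 2 dist≤k) (ℕP.m≤m+n (2 * k) 1))
    where
    dist≤k : ∣ toℕ i - toℕ j ∣ ≤ k
    dist≤k = ℕP.≤-trans (ℕP.∣m-n∣≤m⊔n (toℕ i) (toℕ j))
                        (ℕP.⊔-lub (FinP.toℕ≤pred[n] i) (FinP.toℕ≤pred[n] j))

  a-first-row-injective : Injective _≡_ _≡_ (λ j → a k (cycleVertex zero) (cycleVertex j))
  a-first-row-injective = row-injective
    where
    row : Fin (suc k) → ℕ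
    row j = a k (cycleVertex zero) (cycleVertex j)

    row-suc : ∀ j → row (suc j) + 2 * suc (toℕ j) ≡ 2 * k + 1
    row-suc j = a-cycle zero (suc j) λ ()

    row-suc≢row-zero : ∀ j → row (suc j) ≢ row zero
    row-suc≢row-zero j eq = ℕP.even≢odd (suc (toℕ j)) k (begin
      2 * suc (toℕ j)                ≡⟨ cong (_+ 2 * suc (toℕ j)) (trans eq (a-diagonal (cycleVertex zero))) ⟨
      row (suc j) + 2 * suc (toℕ j)  ≡⟨ row-suc j ⟩
      2 * k + 1                      ≡⟨ ℕP.+-comm (2 * k) 1 ⟩
      suc (2 * k)                    ∎)
      where open ≡-Reasoning

    row-injective : Injective _≡_ _≡_ row
    row-injective {zero}  {zero}  _  = refl
    row-injective {zero}  {suc j} eq = contradiction (sym eq) (row-suc≢row-zero j)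
    row-injective {suc i} {zero}  eq = contradiction eq (row-suc≢row-zero i)
    row-injective {suc i} {suc j} eq = cong suc (FinP.toℕ-injective (ℕP.suc-injective
      (ℕP.*-cancelˡ-≡ _ _ 2 (ℕP.+-cancelˡ-≡ (row (suc i)) _ _ (begin
        row (suc i) + 2 * suc (toℕ i)  ≡⟨ row-suc i ⟩
        2 * k + 1                      ≡⟨ row-suc j ⟨
        row (suc j) + 2 * suc (toℕ j)  ≡⟨ cong (_+ 2 * suc (toℕ j)) eq ⟨
        row (suc i) + 2 * suc (toℕ j)  ∎)))))
      where open ≡-Reasoning

  Δa-unit : ∀ j → Δ aℤ s (cycleVertex j) t s ≡ ℤ.1ℤ
  Δa-unit j = Δ-constant-row aℤ s (cycleVertex j) t s refl

  ∈-allV : ∀ u → u ∈ allV k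
  ∈-allV (inj₁ i) = ∈-++⁺ˡ (∈-map⁺ inj₁ (∈-allFin i))
  ∈-allV (inj₂ x) = ∈-++⁺ʳ _ (∈-map⁺ inj₂ (∈-allFin x))

  ∈-distinctEntries : ∀ (b : V k → V k → ℤ) u v → b u v ∈ deduplicate ℤ._≟_ (entries k b)
  ∈-distinctEntries b u v = ∈-deduplicate⁺ ℤ._≟_
    (∈-concatMap⁺ (λ w → map (b w) (allV k)) (lose (∈-allV u) (∈-map⁺ (b u) (∈-allV v))))

  module _ (b : V k → V k → ℤ) {m : ℤ} (m≢0 : m ≢ ℤ.0ℤ)
           (Δb≡m*Δa : ∀ u u' v v' → Δ b u u' v v' ≡ m ℤ.* Δ aℤ u u' v v') where

    Δb≡0⇒Δa≡0 : ∀ {u u' v v'} → Δ b u u' v v' ≡ ℤ.0ℤ → Δ aℤ u u' v v' ≡ ℤ.0ℤ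
    Δb≡0⇒Δa≡0 {u} {u'} {v} {v'} Δb≡0 =
      [ (λ m≡0 → contradiction m≡0 m≢0) , id ]′
        (ℤP.i*j≡0⇒i≡0∨j≡0 m (trans (sym (Δb≡m*Δa u u' v v')) Δb≡0))

    column-profile : Fin (suc k) → ℤ × ℤ
    column-profile j = b (cycleVertex zero) (cycleVertex j) , b s (cycleVertex j)

    column-profile-injective : Injective _≡_ _≡_ column-profile
    column-profile-injective {i} {j} eq =
      let first-rows , second-rows = ,-injective eq
      in a-first-row-injective (ℤP.+-injective (ℤP.i-j≡0⇒i≡j _ _ (begin
           aℤ v₁ (cycleVertex i) ℤ.- aℤ v₁ (cycleVertex j)
             ≡⟨ Δ-constant-row aℤ v₁ s (cycleVertex i) (cycleVertex j) refl ⟨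
           Δ aℤ v₁ s (cycleVertex i) (cycleVertex j)
             ≡⟨ Δb≡0⇒Δa≡0 (trans (Δ-constant-row b v₁ s (cycleVertex i) (cycleVertex j) second-rows)
                                 (ℤP.i≡j⇒i-j≡0 first-rows)) ⟩
           ℤ.0ℤ ∎)))
      where
      open ≡-Reasoning
      v₁ : V k
      v₁ = cycleVertex zero

    1+k≤numDistinct² : suc k ≤ numDistinct k b * numDistinct k b
    1+k≤numDistinct² = subst (suc k ≤_) (length-cartesianProduct distinct distinct)
      (injective⇒≤-length (cartesianProduct distinct distinct) column-profile-injective
        λ j → ∈-cartesianProduct⁺ (∈-distinctEntries b _ _) (∈-distinctEntries b _ _))
      where
      distinct : List ℤ
      distinct = deduplicate ℤ._≟_ (entries k b)

large-entry : ∀ k (b : V k → V k → ℤ) {m} → m ≢ ℤ.0ℤ →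
              (∀ u u' v v' → Δ b u u' v v' ≡ m ℤ.* Δ (aℤ k) u u' v v') → ∃₂ λ u v → k ≤ ∣ b u v ∣
large-entry zero _ _ _ = s 0 , s 0 , z≤n
large-entry k@(suc n) b {m} m≢0 Δb≡m*Δa =
  let x , y , n<∣bxy∣ = Δ-large-entry b v₁ v₂ v₂ v₁ n 4n<∣Δb∣ in x , y , n<∣bxy∣
  where
  v₁ v₂ : V k
  v₁ = cycleVertex k zero
  v₂ = cycleVertex k (suc zero)

  ≡2n+1 : ∀ {α} → α + 2 * 1 ≡ 2 * k + 1 → α ≡ 2 * n + 1
  ≡2n+1 {α} α+2≡ = ℕP.+-cancelʳ-≡ 2 α (2 * n + 1) (trans α+2≡ (shift n))
    where
    shift : ∀ n → 2 * suc n + 1 ≡ 2 * n + 1 + 2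
    shift = ℕSolver.solve-∀

  Δa≡2[2n+1] : Δ (aℤ k) v₁ v₂ v₂ v₁ ≡ + (2 * n + 1 + (2 * n + 1))
  Δa≡2[2n+1] = begin
    Δ (aℤ k) v₁ v₂ v₂ v₁
      ≡⟨ Δ-zero-diagonal (aℤ k) v₁ v₂ (cong +_ (a-diagonal k v₁)) (cong +_ (a-diagonal k v₂)) ⟩
    + (a k v₁ v₂ + a k v₂ v₁)
      ≡⟨ cong₂ (λ α β → + (α + β)) (≡2n+1 (a-cycle k zero (suc zero) λ ()))
                                   (≡2n+1 (a-cycle k (suc zero) zero λ ())) ⟩
    + (2 * n + 1 + (2 * n + 1)) ∎
    where open ≡-Reasoning

  4n<∣Δb∣ : 4 * n < ∣ Δ b v₁ v₂ v₂ v₁ ∣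
  4n<∣Δb∣ = begin-strict
    4 * n                          <⟨ ℕP.m<n+m (4 * n) {2} (s≤s z≤n) ⟩
    2 + 4 * n                      ≡⟨ 2+4n≡ n ⟩
    2 * n + 1 + (2 * n + 1)        ≡⟨ cong ∣_∣ Δa≡2[2n+1] ⟨
    ∣ Δ (aℤ k) v₁ v₂ v₂ v₁ ∣       ≤⟨ ∣i∣≤∣j*i∣ _ m≢0 ⟩
    ∣ m ℤ.* Δ (aℤ k) v₁ v₂ v₂ v₁ ∣ ≡⟨ cong ∣_∣ (Δb≡m*Δa v₁ v₂ v₂ v₁) ⟨
    ∣ Δ b v₁ v₂ v₂ v₁ ∣            ∎
    where
    open ℕP.≤-Reasoning
    2+4n≡ : ∀ n → 2 + 4 * n ≡ 2 * n + 1 + (2 * n + 1)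
    2+4n≡ = ℕSolver.solve-∀

nV≤2x+4 : ∀ {k x} → k ≤ x → nV k ≤ 2 * x + 4
nV≤2x+4 k≤x = ℕP.+-mono-≤ (ℕP.*-monoʳ-≤ 2 k≤x) (ℕP.n≤1+n 3)

nV∸1≡2[1+k] : ∀ k → nV k ∸ 1 ≡ 2 * suc k
nV∸1≡2[1+k] k = cong (_∸ 1) (nV≡ k)
  where
  nV≡ : ∀ k → 2 * k + 3 ≡ suc (2 * suc k)
  nV≡ = ℕSolver.solve-∀

lemmaA1 : (k : ℕ) (μ : ℚ) → μ ≢ 0ℚ → (λ⁺ λ⁻ : V k → ℚ) → (b : V k → V k → ℤ)
    → (∀ u v → μ ℚ.* ((+ a k u v) / 1) ℚ.+ λ⁺ u ℚ.+ λ⁻ v ≡ b u v / 1)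
    → (∃₂ λ u v → nV k ≤ 2 * ∣ b u v ∣ + 4)
      × (nV k ∸ 1 ≤ 2 * (numDistinct k b * numDistinct k b))
lemmaA1 k μ μ≢0 λ⁺ λ⁻ b b≡μa+λ =
  let m , m≢0 , Δb≡m*Δa = Δ-integral-multiple (aℤ k) b b≡μa+λ μ≢0
                            (s k) (cycleVertex k zero) (t k) (s k) (Δa-unit k zero)
      u , v , k≤∣b∣ = large-entry k b m≢0 Δb≡m*Δa
  in (u , v , nV≤2x+4 k≤∣b∣) , (begin
       nV k ∸ 1                                 ≡⟨ nV∸1≡2[1+k] k ⟩
       2 * suc k                                ≤⟨ ℕP.*-monoʳ-≤ 2 (1+k≤numDistinct² k b m≢0 Δb≡m*Δa) ⟩
       2 * (numDistinct k b * numDistinct k b)  ∎)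
  where open ℕP.≤-Reasoning
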